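{- Let $n\geq 2$, let $q$ be a Dyck path of length $2n-4$, and let $\hat p:=(\nearrow,\nearrow,\searrow,\searrow)\circ q$ and $\check p:=(\nearrow,\searrow,\nearrow,\searrow)\circ q$. Then $h(\hat p)=(\nearrow,\nearrow,\searrow,\searrow)\circ h(q)$ and $h(\check p)=(\nearrow,\searrow,\nearrow,\searrow)\circ h(q)$.
   Context: Lattice paths are sequences of steps $\nearrow$ (upstep) and $\searrow$ (downstep); $\circ$ denotes concatenation and $()$ the empty path. A Dyck path of length $2m$ is a path with $m$ upsteps and $m$ downsteps that, started at height $0$, never goes below height $0$. For a path $q$ of even length $2m$, $\pi_1(q)$ is obtained by swapping the steps at positions $2i$ and $2i+1$ for every $i=1,\ldots,m-1$ ($\pi_1(())=()$). Define $h$ on Dyck paths recursively: $h(()):=()$; if $p=(\nearrow)\circ p'\circ(\searrow)$ with $p'$ a Dyck path, then $h(p):=(\nearrow)\circ\pi_1(h(p'))\circ(\searrow)$; otherwise write $p=p_1\circ p_2$ with $p_1,p_2$ nonempty Dyck paths and set $h(p):=h(p_1)\circ h(p_2)$ (independent of the chosen decomposition). -}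

module Defs where

open import Data.Nat using (ℕ; zero; suc)
open import Data.List using (List; []; _∷_; _++_; length)
open import Data.Product using (_×_; _,_)
open import Data.Unit using (⊤)
open import Data.Empty using (⊥)

-- Steps: U = upstep (↗), D = downstep (↘); paths are lists of steps,
-- concatenation is _++_ and the empty path is [].
data Step : Set where
  U D : Step

Path : Set
Path = List Step

DyckFrom : ℕ → Path → Set
DyckFrom zero    []      = ⊤
DyckFrom (suc _) []      = ⊥
DyckFrom h       (U ∷ p) = DyckFrom (suc h) p
DyckFrom zero    (D ∷ p) = ⊥
DyckFrom (suc h) (D ∷ p) = DyckFrom h p

IsDyck : Path → Set
IsDyck = DyckFrom 0

swapPairs : Path → Path
swapPairs (a ∷ b ∷ r) = b ∷ a ∷ swapPairs r
swapPairs r           = r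

-- π₁: swap steps at positions 2i and 2i+1 (1-indexed) for i = 1..m-1,
-- i.e. keep the first step, then swap consecutive pairs (the last step
-- of an even-length path stays fixed).
π₁ : Path → Path
π₁ []      = []
π₁ (x ∷ p) = x ∷ swapPairs p

-- firstRet d t: splits t = a ++ D ∷ b where that D is the first step
-- bringing the height from d back below d (for well-formed input).
firstRet : ℕ → Path → Path × Path
firstRet d       []      = [] , []
firstRet zero    (D ∷ t) = [] , t
firstRet (suc d) (D ∷ t) with firstRet d t
... | a , b = D ∷ a , b
firstRet d       (U ∷ t) with firstRet (suc d) t
... | a , b = U ∷ a , b

-- h with fuel; on a Dyck path p = (U ∘ p' ∘ D) ∘ rest (first-return
-- decomposition) we get h(p) = (U ∘ π₁(h p') ∘ D) ∘ h(rest), which is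
-- the paper's recursion (using the decomposition p₁ = U p' D, p₂ = rest).
hF : ℕ → Path → Path
hF zero    _       = []
hF (suc k) []      = []
hF (suc k) (D ∷ t) = []
hF (suc k) (U ∷ t) with firstRet 0 t
... | p' , rest = (U ∷ π₁ (hF k p') ++ D ∷ []) ++ hF k rest

h : Path → Path
h p = hF (length p) p

-- Lemma 19 is an instance of the defining recursion of h:
-- for a Dyck path p' and any path rest,
--     h (↗ ∘ p' ∘ ↘ ∘ rest) = (↗ ∘ π₁ (h p') ∘ ↘) ∘ h rest.
-- Writing (↗↗↘↘) ∘ q = ↗ ∘ (↗↘) ∘ ↘ ∘ q and using h (↗↘) = ↗↘ gives the
-- first identity; (↗↘↗↘) ∘ q = ↗ ∘ () ∘ ↘ ∘ ((↗↘) ∘ q), so applying the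
-- recursion twice gives the second.
module Submission where

open import Defs
open import Data.Nat using (ℕ; _≤_; _*_; _∸_; zero; suc; _+_; z≤n; s≤s)
open import Data.Nat.Properties using (≤-trans; ≤-refl; m≤m+n; m≤n+m; n≤1+n)
open import Data.List using ([]; _∷_; _++_; length)
open import Data.List.Properties using (length-++)
open import Data.Product using (_×_; _,_; proj₁; proj₂)
open import Relation.Binary.PropositionalEquality

-- The two pieces returned by the first-return split together are no
-- longer than the input; this bounds the fuel needed in recursive calls.
firstRet-shorter : ∀ d t →
  length (proj₁ (firstRet d t)) + length (proj₂ (firstRet d t)) ≤ length t
firstRet-shorter d       []      = z≤n
firstRet-shorter zero    (D ∷ t) = n≤1+n _
firstRet-shorter (suc d) (D ∷ t) with firstRet d t | firstRet-shorter d t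
... | a , b | le = s≤s le
firstRet-shorter zero    (U ∷ t) with firstRet 1 t | firstRet-shorter 1 t
... | a , b | le = s≤s le
firstRet-shorter (suc d) (U ∷ t) with firstRet (suc (suc d)) t | firstRet-shorter (suc (suc d)) t
... | a , b | le = s≤s le

hF-fuel-irrelevant : ∀ k k' p → length p ≤ k → length p ≤ k' → hF k p ≡ hF k' p
hF-fuel-irrelevant zero     zero     p       _        _        = refl
hF-fuel-irrelevant zero     (suc k') []      _        _        = refl
hF-fuel-irrelevant (suc k)  zero     []      _        _        = refl
hF-fuel-irrelevant (suc k)  (suc k') []      _        _        = refl
hF-fuel-irrelevant (suc k)  (suc k') (D ∷ t) _        _        = refl
hF-fuel-irrelevant (suc k)  (suc k') (U ∷ t) (s≤s l₁) (s≤s l₂)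
  with firstRet 0 t | firstRet-shorter 0 t
... | a , b | le =
  cong₂ (λ x y → (U ∷ π₁ x ++ D ∷ []) ++ y)
    (hF-fuel-irrelevant k k' a (≤-trans (m≤m+n _ _) (≤-trans le l₁))
                              (≤-trans (m≤m+n _ _) (≤-trans le l₂)))
    (hF-fuel-irrelevant k k' b (≤-trans (m≤n+m _ _) (≤-trans le l₁))
                              (≤-trans (m≤n+m _ _) (≤-trans le l₂)))

firstRet-Dyck : ∀ d p r → DyckFrom d p → firstRet d (p ++ D ∷ r) ≡ (p , r)
firstRet-Dyck zero    []      r _  = refl
firstRet-Dyck (suc d) (D ∷ p) r dy rewrite firstRet-Dyck d p r dy = refl
firstRet-Dyck zero    (U ∷ p) r dy rewrite firstRet-Dyck 1 p r dy = refl
firstRet-Dyck (suc d) (U ∷ p) r dy rewrite firstRet-Dyck (suc (suc d)) p r dy = refl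

h-prime : ∀ p' rest → IsDyck p' →
  h (U ∷ p' ++ D ∷ rest) ≡ (U ∷ π₁ (h p') ++ D ∷ []) ++ h rest
h-prime p' rest dy rewrite firstRet-Dyck 0 p' rest dy =
  cong₂ (λ x y → (U ∷ π₁ x ++ D ∷ []) ++ y)
    (hF-fuel-irrelevant k (length p') p' p'≤k ≤-refl)
    (hF-fuel-irrelevant k (length rest) rest rest≤k ≤-refl)
  where
    k : ℕ
    k = length (p' ++ D ∷ rest)

    k≡ : k ≡ length p' + suc (length rest)
    k≡ = length-++ p'

    p'≤k : length p' ≤ k
    p'≤k rewrite k≡ = m≤m+n _ _

    rest≤k : length rest ≤ k
    rest≤k rewrite k≡ = ≤-trans (n≤1+n _) (m≤n+m _ _)

h-peak : ∀ q → h (U ∷ D ∷ q) ≡ U ∷ D ∷ h q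
h-peak q = h-prime [] q _

lemma19 : (n : ℕ) → 2 ≤ n → (q : Path) → IsDyck q → length q ≡ 2 * n ∸ 4 →
    (h ((U ∷ U ∷ D ∷ D ∷ []) ++ q) ≡ (U ∷ U ∷ D ∷ D ∷ []) ++ h q)
    × (h ((U ∷ D ∷ U ∷ D ∷ []) ++ q) ≡ (U ∷ D ∷ U ∷ D ∷ []) ++ h q)
lemma19 _ _ q _ _ = h-prime (U ∷ D ∷ []) q _ , two-peaks
  where
    two-peaks : h (U ∷ D ∷ U ∷ D ∷ q) ≡ U ∷ D ∷ U ∷ D ∷ h q
    two-peaks = begin
      h (U ∷ D ∷ U ∷ D ∷ q)   ≡⟨ h-peak (U ∷ D ∷ q) ⟩
      U ∷ D ∷ h (U ∷ D ∷ q)   ≡⟨ cong (λ y → U ∷ D ∷ y) (h-peak q) ⟩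
      U ∷ D ∷ U ∷ D ∷ h q     ∎
      where open ≡-Reasoning
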